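{- Let $n \ge 2$ be an integer. Every minimal triangle intersects $n\mathbb{Z}^2 = n\mathbb{Z} \times n\mathbb{Z}$ in at most $2$ points. In particular, every subset of $n\mathbb{Z}^2$ is BI-stable.
   Context: A lattice triangle is the convex hull in $\mathbb{R}^2$ of three non-collinear points of $\mathbb{Z}^2$. A triangle is a set $T = \Delta \cap \mathbb{Z}^2$ for a lattice triangle $\Delta$. A triangle is minimal if it contains exactly $4$ points of $\mathbb{Z}^2$; a minimal triangle is a border triangle if its non-vertex point lies on the boundary of $\Delta$, and an internal triangle if that point lies in the interior of $\Delta$. A set $S \subseteq \mathbb{Z}^2$ is BI-stable if no border triangle and no internal triangle has exactly three of its points in $S$. -}

module Defs where

open import Data.Nat using (ℕ; suc)
open import Data.Integer using (ℤ; +_; _+_; _-_; _*_; 0ℤ)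
open import Data.Integer.Divisibility using (_∣_)
open import Data.Product using (_×_; _,_; ∃; ∃-syntax)
open import Data.Sum using (_⊎_)
open import Relation.Binary.PropositionalEquality using (_≡_; _≢_)
open import Relation.Nullary using (¬_)

Point : Set
Point = ℤ × ℤ

det : Point → Point → Point → ℤ
det (ax , ay) (bx , by) (cx , cy) =
  ((bx - ax) * (cy - ay)) - ((by - ay) * (cx - ax))

NonCollinear : Point → Point → Point → Set
NonCollinear a b c = det a b c ≢ 0ℤ

-- p is a convex combination  α a + β b + γ c  with nonnegative rational
-- coefficients (written with a common denominator α + β + γ > 0).
-- For a lattice point p this is exactly  p ∈ conv{a,b,c}.
Comb3 : ℕ → ℕ → ℕ → Point → Point → Point → Point → Set
Comb3 α β γ (ax , ay) (bx , by) (cx , cy) (px , py) =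
  ((+ (α Data.Nat.+ β Data.Nat.+ γ)) * px ≡ (+ α) * ax + (+ β) * bx + (+ γ) * cx)
  × ((+ (α Data.Nat.+ β Data.Nat.+ γ)) * py ≡ (+ α) * ay + (+ β) * by + (+ γ) * cy)

-- p ∈ Δ = conv{a,b,c}  (p ∈ ℤ² automatically), i.e. p ∈ T = Δ ∩ ℤ².
InTri : Point → Point → Point → Point → Set
InTri a b c p = ∃[ α ] ∃[ β ] ∃[ γ ] (¬ (α Data.Nat.+ β Data.Nat.+ γ ≡ 0) × Comb3 α β γ a b c p)

InInterior : Point → Point → Point → Point → Set
InInterior a b c p = ∃[ α ] ∃[ β ] ∃[ γ ] Comb3 (suc α) (suc β) (suc γ) a b c p

InSeg : Point → Point → Point → Set
InSeg a b p = ∃[ α ] ∃[ β ] (¬ (α Data.Nat.+ β ≡ 0) × Comb3 α β 0 a b a p)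

OnBoundary : Point → Point → Point → Point → Set
OnBoundary a b c p = InSeg a b p ⊎ InSeg b c p ⊎ InSeg a c p

IsVertex : Point → Point → Point → Point → Set
IsVertex a b c p = p ≡ a ⊎ p ≡ b ⊎ p ≡ c

Minimal : Point → Point → Point → Set
Minimal a b c =
  ∃[ p₁ ] ∃[ p₂ ] ∃[ p₃ ] ∃[ p₄ ]
    ( (p₁ ≢ p₂) × (p₁ ≢ p₃) × (p₁ ≢ p₄) × (p₂ ≢ p₃) × (p₂ ≢ p₄) × (p₃ ≢ p₄)
    × (∀ q → InTri a b c q → (q ≡ p₁ ⊎ q ≡ p₂ ⊎ q ≡ p₃ ⊎ q ≡ p₄))
    × InTri a b c p₁ × InTri a b c p₂ × InTri a b c p₃ × InTri a b c p₄ )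

BorderTriangle : Point → Point → Point → Set
BorderTriangle a b c =
  Minimal a b c × (∃[ d ] (InTri a b c d × ¬ IsVertex a b c d × OnBoundary a b c d))

InternalTriangle : Point → Point → Point → Set
InternalTriangle a b c =
  Minimal a b c × (∃[ d ] (InTri a b c d × ¬ IsVertex a b c d × InInterior a b c d))

ExactlyThreeIn : (Point → Set) → Point → Point → Point → Set
ExactlyThreeIn S a b c =
  ∃[ p ] ∃[ q ] ∃[ r ]
    ( (p ≢ q) × (p ≢ r) × (q ≢ r)
    × InTri a b c p × InTri a b c q × InTri a b c r
    × S p × S q × S r
    × (∀ t → InTri a b c t → S t → (t ≡ p ⊎ t ≡ q ⊎ t ≡ r)) )

BIStable : (Point → Set) → Set
BIStable S = ∀ a b c → NonCollinear a b c →
  (BorderTriangle a b c ⊎ InternalTriangle a b c) → ¬ ExactlyThreeIn S a b c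

InNZ2 : ℕ → Point → Set
InNZ2 n (x , y) = ((+ n) ∣ x) × ((+ n) ∣ y)

ThreeInNZ2 : ℕ → Point → Point → Point → Set
ThreeInNZ2 n a b c =
  ∃[ p ] ∃[ q ] ∃[ r ]
    ( (p ≢ q) × (p ≢ r) × (q ≢ r)
    × InTri a b c p × InTri a b c q × InTri a b c r
    × InNZ2 n p × InNZ2 n q × InNZ2 n r )

-- Write the three points of nℤ² in T as p, p + N u and p + N w, where N ≥ 2 and
-- u, w, u − w ≠ 0.  By convexity T contains p + k u and p + k w for k ≤ N.  If
-- i u ≠ j w for all i, j ∈ {1, 2}, then p, p + u, p + 2u, p + w, p + 2w are five
-- distinct points of T.  Otherwise w = 2u or u = 2w, say w = 2u; then T contains
-- p + k u for all k ≤ 2N, which again gives five distinct points.  A minimal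
-- triangle has only four.
module Submission where

open import Defs
open import Data.Nat using (ℕ; _≤_)
open import Data.Product using (_×_)
open import Relation.Nullary using (¬_)

open import Data.Empty using (⊥; ⊥-elim)
open import Data.Fin using (Fin; zero; suc; toℕ; splitAt)
import Data.Fin.Properties as Fin
open import Data.Integer using (ℤ; +_; _+_; _-_; _*_; 0ℤ; 1ℤ; _≟_)
import Data.Integer as ℤ
open import Data.Integer.Divisibility using (_∣_)
import Data.Integer.Divisibility.Signed as Signed
import Data.Integer.Properties as ℤ
open import Algebra.Properties.AbelianGroup ℤ.+-0-abelianGroup
  using () renaming (∙-cancelˡ to +-cancelˡ)
open import Data.Integer.Tactic.RingSolver using (solve; solve-∀)
import Data.Nat as ℕ
import Data.Nat.Properties as ℕ
import Data.Nat.Tactic.RingSolver as ℕ-Solver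
open import Data.List using (_∷_; [])
open import Data.Product using (_,_; proj₁; proj₂; ∃)
open import Data.Product.Properties using (≡-dec)
open import Data.Sum using (_⊎_; inj₁; inj₂; [_,_]′)
open import Function using (_∘_; flip; Injection)
open import Function.Definitions using (Injective)
open import Function.Properties.Inverse using (↔⇒↣)
open import Relation.Binary.Definitions using (DecidableEquality)
open import Relation.Binary.PropositionalEquality
open import Relation.Nullary using (Dec; yes; no)

infixl 6 _⊕_
infixr 7 _·_

_⊕_ : Point → Point → Point
(x , y) ⊕ (x′ , y′) = (x + x′ , y + y′)

_·_ : ℤ → Point → Point
k · (x , y) = (k * x , k * y)

0ᵥ : Point
0ᵥ = (0ℤ , 0ℤ)

infix 4 _≟ᵥ_
_≟ᵥ_ : DecidableEquality Point
_≟ᵥ_ = ≡-dec _≟_ _≟_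

⊕-cancelˡ : ∀ p {u v} → p ⊕ u ≡ p ⊕ v → u ≡ v
⊕-cancelˡ (x , y) {_ , _} {_ , _} e =
  cong₂ _,_ (+-cancelˡ x _ _ (cong proj₁ e)) (+-cancelˡ y _ _ (cong proj₂ e))

·-cancelˡ : ∀ k .{{_ : ℤ.NonZero k}} {u v} → k · u ≡ k · v → u ≡ v
·-cancelˡ k {_ , _} {_ , _} e =
  cong₂ _,_ (ℤ.*-cancelˡ-≡ k _ _ (cong proj₁ e)) (ℤ.*-cancelˡ-≡ k _ _ (cong proj₂ e))

·-cancelʳ : ∀ {i j} u → u ≢ 0ᵥ → i · u ≡ j · u → i ≡ j
·-cancelʳ {i} {j} (x , y) u≢0 e with x ≟ 0ℤ | y ≟ 0ℤ
... | no x≢0 | _      = ℤ.*-cancelʳ-≡ i j x {{ℤ.≢-nonZero x≢0}} (cong proj₁ e)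
... | yes _  | no y≢0 = ℤ.*-cancelʳ-≡ i j y {{ℤ.≢-nonZero y≢0}} (cong proj₂ e)
... | yes refl | yes refl = ⊥-elim (u≢0 refl)

·-identityˡ : ∀ u → 1ℤ · u ≡ u
·-identityˡ (x , y) = cong₂ _,_ (ℤ.*-identityˡ x) (ℤ.*-identityˡ y)

·-assoc : ∀ k l u → k · l · u ≡ (k * l) · u
·-assoc k l (x , y) = cong₂ _,_ (sym (ℤ.*-assoc k l x)) (sym (ℤ.*-assoc k l y))

⊕-·-0ᵥ : ∀ p k → p ⊕ k · 0ᵥ ≡ p
⊕-·-0ᵥ (x , y) k = cong₂ _,_ (vanish x) (vanish y)
  where
  vanish : ∀ z → z + k * 0ℤ ≡ z
  vanish z = trans (cong (λ e → z + e) (ℤ.*-zeroʳ k)) (ℤ.+-identityʳ z)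

ray-injective : ∀ p {u i j} → u ≢ 0ᵥ → p ⊕ + i · u ≡ p ⊕ + j · u → i ≡ j
ray-injective p {u} u≢0 e = ℤ.+-injective (·-cancelʳ u u≢0 (⊕-cancelˡ p e))

∣-offset : ∀ {n} x y → + n ∣ x → + n ∣ y → ∃ λ d → y ≡ x + + n * d
∣-offset {n} x y n∣x n∣y
  with Signed.divides d y-x≡d*n ←
         Signed.∣m∣n⇒∣m-n (Signed.∣ᵤ⇒∣ {i = y} n∣y) (Signed.∣ᵤ⇒∣ {i = x} n∣x) =
  d , (begin
    y               ≡⟨ solve (x ∷ y ∷ []) ⟩
    x + (y - x)     ≡⟨ cong (λ e → x + e) y-x≡d*n ⟩
    x + d * + n     ≡⟨ cong (λ e → x + e) (ℤ.*-comm d (+ n)) ⟩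
    x + + n * d     ∎)
  where open ≡-Reasoning

nℤ²-offset : ∀ {n} p q → InNZ2 n p → InNZ2 n q → ∃ λ u → q ≡ p ⊕ + n · u
nℤ²-offset (x , y) (x′ , y′) (n∣x , n∣y) (n∣x′ , n∣y′)
  with dx , x′≡ ← ∣-offset x x′ n∣x n∣x′ | dy , y′≡ ← ∣-offset y y′ n∣y n∣y′ =
  (dx , dy) , cong₂ _,_ x′≡ y′≡

barycentric-compose : ∀ {L l m s t α β γ α′ β′ γ′ A B C X Y Z : ℤ} →
  s * X ≡ α * A + β * B + γ * C →
  t * Y ≡ α′ * A + β′ * B + γ′ * C →
  L * Z ≡ l * X + m * Y →
  L * s * t * Z ≡ (l * t * α + m * s * α′) * A + (l * t * β + m * s * β′) * B
                + (l * t * γ + m * s * γ′) * C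
barycentric-compose {L} {l} {m} {s} {t} {α} {β} {γ} {α′} {β′} {γ′} {A} {B} {C} {X} {Y} {Z}
  sX tY LZ = begin
  L * s * t * Z                      ≡⟨ solve (L ∷ s ∷ t ∷ Z ∷ []) ⟩
  s * t * (L * Z)                    ≡⟨ cong (s * t *_) LZ ⟩
  s * t * (l * X + m * Y)            ≡⟨ solve (l ∷ m ∷ s ∷ t ∷ X ∷ Y ∷ []) ⟩
  l * t * (s * X) + m * s * (t * Y)  ≡⟨ cong₂ (λ u v → l * t * u + m * s * v) sX tY ⟩
  l * t * (α * A + β * B + γ * C) + m * s * (α′ * A + β′ * B + γ′ * C)
    ≡⟨ solve (l ∷ m ∷ s ∷ t ∷ α ∷ β ∷ γ ∷ α′ ∷ β′ ∷ γ′ ∷ A ∷ B ∷ C ∷ []) ⟩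
  (l * t * α + m * s * α′) * A + (l * t * β + m * s * β′) * B
    + (l * t * γ + m * s * γ′) * C ∎
  where open ≡-Reasoning

*-≢0 : ∀ {m n} → m ≢ 0 → n ≢ 0 → m ℕ.* n ≢ 0
*-≢0 m≢0 n≢0 mn≡0 = [ m≢0 , n≢0 ]′ (ℕ.m*n≡0⇒m≡0∨n≡0 _ mn≡0)

pos-*³ : ∀ a b c → + (a ℕ.* b ℕ.* c) ≡ + a * + b * + c
pos-*³ a b c = trans (ℤ.pos-* (a ℕ.* b) c) (cong (_* + c) (ℤ.pos-* a b))

weights-sum : ∀ l m α β γ α′ β′ γ′ →
  let s = α ℕ.+ β ℕ.+ γ; t = α′ ℕ.+ β′ ℕ.+ γ′ in
  (l ℕ.* t ℕ.* α ℕ.+ m ℕ.* s ℕ.* α′) ℕ.+ (l ℕ.* t ℕ.* β ℕ.+ m ℕ.* s ℕ.* β′)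
    ℕ.+ (l ℕ.* t ℕ.* γ ℕ.+ m ℕ.* s ℕ.* γ′)
  ≡ (l ℕ.+ m) ℕ.* s ℕ.* t
weights-sum = ℕ-Solver.solve-∀

InTri-segment : ∀ {a b c x y z} (l m : ℕ) → l ℕ.+ m ≢ 0 →
  InTri a b c x → InTri a b c y → + (l ℕ.+ m) · z ≡ + l · x ⊕ + m · y → InTri a b c z
InTri-segment {_ , _} {_ , _} {_ , _} {_ , _} {_ , _} {_ , _} l m l+m≢0
  (α , β , γ , s≢0 , x₁≡ , x₂≡) (α′ , β′ , γ′ , t≢0 , y₁≡ , y₂≡) z≡ =
  weight α α′ , weight β β′ , weight γ γ′ ,
  subst (_≢ 0) (sym total) (*-≢0 (*-≢0 l+m≢0 s≢0) t≢0) ,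
  coordinate x₁≡ y₁≡ (cong proj₁ z≡) , coordinate x₂≡ y₂≡ (cong proj₂ z≡)
  where
  s t : ℕ
  s = α ℕ.+ β ℕ.+ γ
  t = α′ ℕ.+ β′ ℕ.+ γ′

  weight : ℕ → ℕ → ℕ
  weight u v = l ℕ.* t ℕ.* u ℕ.+ m ℕ.* s ℕ.* v

  total : weight α α′ ℕ.+ weight β β′ ℕ.+ weight γ γ′ ≡ (l ℕ.+ m) ℕ.* s ℕ.* t
  total = weights-sum l m α β γ α′ β′ γ′

  +weight : ∀ u v → + weight u v ≡ + l * + t * + u + + m * + s * + v
  +weight u v = trans (ℤ.pos-+ (l ℕ.* t ℕ.* u) _) (cong₂ _+_ (pos-*³ l t u) (pos-*³ m s v))

  coordinate : ∀ {A B C X Y Z} →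
    + s * X ≡ + α * A + + β * B + + γ * C →
    + t * Y ≡ + α′ * A + + β′ * B + + γ′ * C →
    + (l ℕ.+ m) * Z ≡ + l * X + + m * Y →
    + (weight α α′ ℕ.+ weight β β′ ℕ.+ weight γ γ′) * Z
      ≡ + weight α α′ * A + + weight β β′ * B + + weight γ γ′ * C
  coordinate {A} {B} {C} {Z = Z} sX tY LZ = begin
    + (weight α α′ ℕ.+ weight β β′ ℕ.+ weight γ γ′) * Z
      ≡⟨ cong (λ w → + w * Z) total ⟩
    + ((l ℕ.+ m) ℕ.* s ℕ.* t) * Z
      ≡⟨ cong (_* Z) (pos-*³ (l ℕ.+ m) s t) ⟩
    + (l ℕ.+ m) * + s * + t * Z
      ≡⟨ barycentric-compose {L = + (l ℕ.+ m)} {+ l} {+ m} {+ s} {+ t} sX tY LZ ⟩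
    _ ≡⟨ sym (cong₂ _+_ (cong₂ _+_ (cong (_* A) (+weight α α′)) (cong (_* B) (+weight β β′)))
                        (cong (_* C) (+weight γ γ′))) ⟩
    + weight α α′ * A + + weight β β′ * B + + weight γ γ′ * C ∎
    where open ≡-Reasoning

ray-combination : ∀ (K O P U : ℤ) → (K + O) * (P + K * U) ≡ K * (P + (K + O) * U) + O * P
ray-combination = solve-∀

InTri-ray : ∀ {a b c p u} M .{{_ : ℕ.NonZero M}} {k} → k ≤ M →
  InTri a b c p → InTri a b c (p ⊕ + M · u) → InTri a b c (p ⊕ + k · u)
InTri-ray {p = px , py} {u = ux , uy} M {k} k≤M p∈T q∈T with ℕ.m≤n⇒∃[o]m+o≡n k≤M
... | o , refl =
  InTri-segment k o (ℕ.≢-nonZero⁻¹ (k ℕ.+ o)) q∈T p∈T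
    (cong₂ _,_ (coordinate px ux) (coordinate py uy))
  where
  coordinate : ∀ P U → + (k ℕ.+ o) * (P + + k * U) ≡ + k * (P + + (k ℕ.+ o) * U) + + o * P
  coordinate P U rewrite ℤ.pos-+ k o = ray-combination (+ k) (+ o) P U

Minimal⇒four-points : ∀ {a b c} → Minimal a b c →
  ∃ λ (corner : Fin 4 → Point) → ∀ q → InTri a b c q → ∃ λ k → q ≡ corner k
Minimal⇒four-points (p₁ , p₂ , p₃ , p₄ , _ , _ , _ , _ , _ , _ , covered , _) =
  corner , λ q → locate ∘ covered q
  where
  corner : Fin 4 → Point
  corner zero                   = p₁
  corner (suc zero)             = p₂
  corner (suc (suc zero))       = p₃
  corner (suc (suc (suc zero))) = p₄

  locate : ∀ {q} → q ≡ p₁ ⊎ q ≡ p₂ ⊎ q ≡ p₃ ⊎ q ≡ p₄ → ∃ λ k → q ≡ corner k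
  locate (inj₁ q≡p₁)               = zero , q≡p₁
  locate (inj₂ (inj₁ q≡p₂))        = suc zero , q≡p₂
  locate (inj₂ (inj₂ (inj₁ q≡p₃))) = suc (suc zero) , q≡p₃
  locate (inj₂ (inj₂ (inj₂ q≡p₄))) = suc (suc (suc zero)) , q≡p₄

Minimal⇒¬injective : ∀ {a b c m} → Minimal a b c → 4 ℕ.< m → (f : Fin m → Point) →
  (∀ i → InTri a b c (f i)) → ¬ Injective _≡_ _≡_ f
Minimal⇒¬injective T-minimal 4<m f f∈T f-injective
  with corner , locate ← Minimal⇒four-points T-minimal
  with i , j , i<j , same-index ← Fin.pigeonhole 4<m (λ i → proj₁ (locate (f i) (f∈T i)))
  = Fin.<⇒≢ i<j (f-injective (trans (proj₂ (locate (f i) (f∈T i)))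
      (trans (cong corner same-index) (sym (proj₂ (locate (f j) (f∈T j)))))))

Minimal⇒¬five-on-ray : ∀ {a b c p u} → Minimal a b c → u ≢ 0ᵥ →
  (∀ {k} → k ≤ 4 → InTri a b c (p ⊕ + k · u)) → ⊥
Minimal⇒¬five-on-ray {p = p} {u} T-minimal u≢0 ray⊆T =
  Minimal⇒¬injective T-minimal (ℕ.n<1+n 4) (λ i → p ⊕ + toℕ i · u)
    (λ i → ray⊆T (Fin.toℕ≤pred[n] i)) (λ e → Fin.toℕ-injective (ray-injective p u≢0 e))

Minimal⇒¬two-rays : ∀ {a b c p u w} → Minimal a b c → u ≢ 0ᵥ → w ≢ 0ᵥ →
  (∀ (i j : Fin 2) → + ℕ.suc (toℕ i) · u ≢ + ℕ.suc (toℕ j) · w) →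
  (∀ {k} → k ≤ 2 → InTri a b c (p ⊕ + k · u)) →
  (∀ {k} → k ≤ 2 → InTri a b c (p ⊕ + k · w)) → ⊥
Minimal⇒¬two-rays {a} {b} {c} {p} {u} {w} T-minimal u≢0 w≢0 rays-apart u-ray⊆T w-ray⊆T =
  Minimal⇒¬injective T-minimal (ℕ.n<1+n 4) (point ∘ splitAt 3) (point∈T ∘ splitAt 3)
    (Injection.injective (↔⇒↣ Fin.+↔⊎) ∘ injective)
  where
  point : Fin 3 ⊎ Fin 2 → Point
  point (inj₁ i) = p ⊕ + toℕ i · u
  point (inj₂ j) = p ⊕ + ℕ.suc (toℕ j) · w

  point∈T : ∀ x → InTri a b c (point x)
  point∈T (inj₁ i) = u-ray⊆T (Fin.toℕ≤pred[n] i)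
  point∈T (inj₂ j) = w-ray⊆T (ℕ.s≤s (Fin.toℕ≤pred[n] j))

  injective : Injective _≡_ _≡_ point
  injective {inj₁ i} {inj₁ i′} e = cong inj₁ (Fin.toℕ-injective (ray-injective p u≢0 e))
  injective {inj₂ j} {inj₂ j′} e =
    cong inj₂ (Fin.toℕ-injective (ℕ.suc-injective (ray-injective p w≢0 e)))
  injective {inj₁ zero} {inj₂ j} e
    with () ← ·-cancelʳ {+ 0} {+ ℕ.suc (toℕ j)} w w≢0 (⊕-cancelˡ p e)
  injective {inj₁ (suc i)} {inj₂ j} e = ⊥-elim (rays-apart i j (⊕-cancelˡ p e))
  injective {inj₂ j} {inj₁ zero} e
    with () ← ·-cancelʳ {+ ℕ.suc (toℕ j)} {+ 0} w w≢0 (⊕-cancelˡ p e)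
  injective {inj₂ j} {inj₁ (suc i)} e = ⊥-elim (rays-apart i j (sym (⊕-cancelˡ p e)))

Minimal⇒¬scaled-triple : ∀ {a b c p u w} N → 2 ≤ N → Minimal a b c →
  InTri a b c p → InTri a b c (p ⊕ + N · u) → InTri a b c (p ⊕ + N · w) →
  u ≢ 0ᵥ → w ≢ 0ᵥ → u ≢ w → ⊥
Minimal⇒¬scaled-triple {a} {b} {c} {p} {u} {w} N 2≤N@(ℕ.s≤s (ℕ.s≤s _)) T-minimal p∈T q∈T r∈T
  u≢0 w≢0 u≢w =
  by-cases (+ 2 · u ≟ᵥ w) (+ 2 · w ≟ᵥ u)
  where
  ray⊆T : ∀ {v} → InTri a b c (p ⊕ + N · v) → ∀ {k} → k ≤ 2 → InTri a b c (p ⊕ + k · v)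
  ray⊆T q∈T k≤2 = InTri-ray N (ℕ.≤-trans k≤2 2≤N) p∈T q∈T

  doubled-ray⊆T : ∀ {v} → InTri a b c (p ⊕ + N · + 2 · v) →
    ∀ {k} → k ≤ 4 → InTri a b c (p ⊕ + k · v)
  doubled-ray⊆T {v} r∈T k≤4 =
    InTri-ray (N ℕ.* 2) (ℕ.≤-trans k≤4 (ℕ.*-monoˡ-≤ 2 2≤N)) p∈T
      (subst (InTri a b c ∘ (p ⊕_))
        (trans (·-assoc (+ N) (+ 2) v) (cong (_· v) (sym (ℤ.pos-* N 2)))) r∈T)

  rays-apart : + 2 · u ≢ w → + 2 · w ≢ u →
    ∀ (i j : Fin 2) → + ℕ.suc (toℕ i) · u ≢ + ℕ.suc (toℕ j) · w
  rays-apart _    _    zero       zero       = u≢w ∘ ·-cancelˡ (+ 1)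
  rays-apart _    2w≢u zero       (suc zero) = 2w≢u ∘ sym ∘ trans (sym (·-identityˡ u))
  rays-apart 2u≢w _    (suc zero) zero       = 2u≢w ∘ flip trans (·-identityˡ w)
  rays-apart _    _    (suc zero) (suc zero) = u≢w ∘ ·-cancelˡ (+ 2)

  by-cases : Dec (+ 2 · u ≡ w) → Dec (+ 2 · w ≡ u) → ⊥
  by-cases (yes 2u≡w) _ =
    Minimal⇒¬five-on-ray {p = p} T-minimal u≢0
      (doubled-ray⊆T (subst (InTri a b c ∘ (p ⊕_) ∘ (+ N ·_)) (sym 2u≡w) r∈T))
  by-cases (no _) (yes 2w≡u) =
    Minimal⇒¬five-on-ray {p = p} T-minimal w≢0
      (doubled-ray⊆T (subst (InTri a b c ∘ (p ⊕_) ∘ (+ N ·_)) (sym 2w≡u) q∈T))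
  by-cases (no 2u≢w) (no 2w≢u) =
    Minimal⇒¬two-rays {p = p} T-minimal u≢0 w≢0 (rays-apart 2u≢w 2w≢u) (ray⊆T q∈T) (ray⊆T r∈T)

Minimal⇒¬ThreeInNZ2 : ∀ {n a b c} → 2 ≤ n → Minimal a b c → ¬ ThreeInNZ2 n a b c
Minimal⇒¬ThreeInNZ2 {n} 2≤n T-minimal
  (p , q , r , p≢q , p≢r , q≢r , p∈T , q∈T , r∈T , p∈nℤ² , q∈nℤ² , r∈nℤ²)
  with u , refl ← nℤ²-offset p q p∈nℤ² q∈nℤ² | w , refl ← nℤ²-offset p r p∈nℤ² r∈nℤ² =
  Minimal⇒¬scaled-triple n 2≤n T-minimal p∈T q∈T r∈T
    (λ { refl → p≢q (sym (⊕-·-0ᵥ p (+ n))) })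
    (λ { refl → p≢r (sym (⊕-·-0ᵥ p (+ n))) })
    (λ { refl → q≢r refl })

proposition2p1 : (n : ℕ) → 2 ≤ n →
    (∀ a b c → NonCollinear a b c → Minimal a b c → ¬ ThreeInNZ2 n a b c)
    × (∀ (S : Point → Set) → (∀ p → S p → InNZ2 n p) → BIStable S)
proposition2p1 n 2≤n =
  (λ _ _ _ _ → Minimal⇒¬ThreeInNZ2 2≤n) ,
  λ { S S⊆nℤ² _ _ _ _ triangle
        (p , q , r , p≢q , p≢r , q≢r , p∈T , q∈T , r∈T , Sp , Sq , Sr , _) →
        Minimal⇒¬ThreeInNZ2 2≤n ([ proj₁ , proj₁ ]′ triangle)
          (p , q , r , p≢q , p≢r , q≢r , p∈T , q∈T , r∈T , S⊆nℤ² p Sp , S⊆nℤ² q Sq , S⊆nℤ² r Sr) }
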